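{- Let $\mathfrak S$ be a compatible split system on a multiset $\mathcal M$ and let $\mathcal T=(T,\lambda)$ be an $\mathcal M$-tree representing $\mathfrak S$. Then for every terminal set $A$ of $\mathfrak S$ there exists a leaf $x$ of $T$ with $\lambda(x)=A$.
   Context: A multiset $\mathcal M$ has underlying set $X$ with multiplicities $\mathcal M(x)\ge1$. Unions, inclusions and differences are in the multiset sense. A split of $\mathcal M$ is an unordered pair $\{A,B\}$, written $A|B$, of nonempty submultisets with multiset union $\mathcal M$; $\overline A=\mathcal M-A$. A split system on $\mathcal M$ is a finite multiset of splits. An $\mathcal M$-tree is a finite tree $T$ with a labeling $\lambda$ of vertices by submultisets of $\mathcal M$ such that the multiset union of all labels is $\mathcal M$ and every vertex of degree $1$ or $2$ has nonempty label. Each edge $e$ induces the split $A|B$ with $A$, $B$ the multiset unions of labels in the two components of $T-e$; the tree represents the multiset of splits induced by all its edges. A split system is compatible if some $\mathcal M$-tree represents it. For $\mathfrak S=\{S_1,\dots,S_n\}$, a submultiset $A$ is a terminal set of $\mathfrak S$ if $A|\overline A=S_i$ for some $i$ and for every $j\neq i$ with $S_j=B|\overline B$, neither $B\subsetneq A$ nor $\overline B\subsetneq A$ holds. -}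

module Defs where

open import Data.Nat using (ℕ; zero; suc; _+_; _∸_; _≤_; _<_)
open import Data.Fin using (Fin; zero; suc; toℕ; _≟_)
open import Data.Bool using (Bool; true; false; if_then_else_)
open import Data.Product using (Σ; ∃; _×_; _,_; proj₁; proj₂)
open import Data.Sum using (_⊎_)
open import Data.List using (length; filter)
open import Data.List using (List)
open import Data.Fin.Base using ()
open import Data.List.Base using ()
open import Relation.Nullary using (¬_; does)
open import Relation.Binary.PropositionalEquality using (_≡_; _≢_)
open import Function.Bundles using (_↔_; Inverse)

Multiset : ℕ → Set
Multiset k = Fin k → ℕ

module _ {k : ℕ} where

  _≋_ : Multiset k → Multiset k → Set
  A ≋ B = ∀ x → A x ≡ B x

  _⊆_ : Multiset k → Multiset k → Set
  A ⊆ B = ∀ x → A x ≤ B x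

  _⊊_ : Multiset k → Multiset k → Set
  A ⊊ B = A ⊆ B × ¬ (A ≋ B)

  _∪ₘ_ : Multiset k → Multiset k → Multiset k
  (A ∪ₘ B) x = A x + B x

  _∖_ : Multiset k → Multiset k → Multiset k
  (A ∖ B) x = A x ∸ B x

  ∅ₘ : Multiset k
  ∅ₘ _ = 0

  Nonempty : Multiset k → Set
  Nonempty A = ∃ λ x → 0 < A x

ΣF : {m : ℕ} → (Fin m → ℕ) → ℕ
ΣF {zero}  f = 0
ΣF {suc m} f = f zero + ΣF (λ i → f (suc i))

⋃F : {k m : ℕ} → (Fin m → Multiset k) → Multiset k
⋃F f x = ΣF (λ i → f i x)

-- a (candidate) split, as a pair of multisets; unordered-ness is
-- handled by the equality _≈ₛ_ below
Pair : ℕ → Set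
Pair k = Multiset k × Multiset k

IsSplit : {k : ℕ} → Multiset k → Pair k → Set
IsSplit ℳ (A , B) = Nonempty A × Nonempty B × ((A ∪ₘ B) ≋ ℳ)

_≈ₛ_ : {k : ℕ} → Pair k → Pair k → Set
(A , B) ≈ₛ (C , D) = ((A ≋ C) × (B ≋ D)) ⊎ ((A ≋ D) × (B ≋ C))

-- a split system on ℳ: a finite multiset of splits, given as a family
record SplitSystem {k : ℕ} (ℳ : Multiset k) : Set where
  field
    size    : ℕ
    split   : Fin size → Pair k
    isSplit : ∀ i → IsSplit ℳ (split i)

-- Finite trees, encoded by a parent function.
-- Vertices are Fin (suc n), vertex zero is a root; vertex (suc i) has
-- parent (parent i), whose index is smaller.  Every finite tree is
-- isomorphic to such a tree.  The edges are the pairs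
-- {suc i , parent i}, indexed by i : Fin n.

record Tree : Set where
  field
    n       : ℕ
    parent  : Fin n → Fin (suc n)
    ordered : ∀ i → toℕ (parent i) ≤ toℕ i

  Vertex : Set
  Vertex = Fin (suc n)

  Edge : Set
  Edge = Fin n

  children : Vertex → ℕ
  children v = length (filter (λ i → parent i ≟ v) (Data.List.allFin n))
    where import Data.List

  degree : Vertex → ℕ
  degree zero    = children zero
  degree (suc i) = suc (children (suc i))

  -- below f u v : v lies in the subtree rooted at u (fuel f; the fuel
  -- suc n used below is enough since parent indices strictly decrease)
  below : ℕ → Vertex → Vertex → Bool
  below f u v with does (u ≟ v)
  below f       u v       | true  = true
  below zero    u v       | false = false
  below (suc f) u zero    | false = false
  below (suc f) u (suc i) | false = below f u (parent i)

  inSubtree : Edge → Vertex → Bool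
  inSubtree e v = below (suc n) (suc e) v

open Tree public

record MTree {k : ℕ} (ℳ : Multiset k) : Set where
  field
    tree     : Tree
    label    : Vertex tree → Multiset k
    labelsUnion : ⋃F label ≋ ℳ
    labelsLeaf  : ∀ v → (degree tree v ≡ 1 ⊎ degree tree v ≡ 2) → Nonempty (label v)

  edgeSplit : Edge tree → Pair k
  edgeSplit e =
    ( ⋃F (λ v → if inSubtree tree e v then label v else ∅ₘ)
    , ⋃F (λ v → if inSubtree tree e v then ∅ₘ else label v) )

  isLeaf : Vertex tree → Set
  isLeaf v = degree tree v ≡ 1

open MTree public

Represents : {k : ℕ} {ℳ : Multiset k} → MTree ℳ → SplitSystem ℳ → Set
Represents 𝒯 𝔖 =
  Σ (Edge (tree 𝒯) ↔ Fin (SplitSystem.size 𝔖)) λ σ →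
    ∀ e → edgeSplit 𝒯 e ≈ₛ SplitSystem.split 𝔖 (Inverse.to σ e)

Compatible : {k : ℕ} {ℳ : Multiset k} → SplitSystem ℳ → Set
Compatible {ℳ = ℳ} 𝔖 = Σ (MTree ℳ) λ 𝒯 → Represents 𝒯 𝔖

TerminalSet : {k : ℕ} {ℳ : Multiset k} → SplitSystem ℳ → Multiset k → Set
TerminalSet {ℳ = ℳ} 𝔖 A =
  Σ (Fin (SplitSystem.size 𝔖)) λ i →
    ((A , ℳ ∖ A) ≈ₛ SplitSystem.split 𝔖 i) ×
    (∀ j → j ≢ i →
       ¬ (proj₁ (SplitSystem.split 𝔖 j) ⊊ A) ×
       ¬ (proj₂ (SplitSystem.split 𝔖 j) ⊊ A))

-- Let e be the edge whose split has A as a side and u the endpoint of e on that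
-- side.  For every other edge f at u, the far side of f (the component of T − f
-- avoiding u) lies inside A, and strictly so: either λ(u) is nonempty, or a
-- third edge at u contributes its far side, which is nonempty because every
-- side of a split is; otherwise u would have degree 2 and an empty label.
-- Terminality of A excludes such an f, so u is a leaf, and then A = λ(u).
module Submission where

open import Defs
open import Data.Bool using (Bool; true; false; not; if_then_else_)
open import Data.Bool.Properties using (not-involutive; not-¬)
open import Data.Empty using (⊥; ⊥-elim)
open import Data.Fin using (Fin; zero; suc; toℕ; _≟_)
open import Data.Fin.Properties using (suc-injective; toℕ≤pred[n]; any?)
open import Data.List using (length; filter; tabulate)
open import Data.Nat using (ℕ; zero; suc; _+_; _≤_; _<_; _≥_; z≤n; s≤s; _<?_)
open import Data.Nat.Properties
  using ( ≤-refl; ≤-reflexive; ≤-trans; <-≤-trans; <⇒≢; 1+n≰n; n≤1+n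
        ; +-comm; +-identityʳ; +-mono-≤; m≤m+n; m<m+n; +-commutativeSemigroup )
open import Algebra.Properties.CommutativeSemigroup +-commutativeSemigroup using (interchange)
open import Data.Product using (Σ; ∃; ∃₂; _×_; _,_; proj₁; proj₂)
open import Data.Sum using (_⊎_; inj₁; inj₂)
open import Function using (_∘_)
open import Function.Bundles using (Inverse)
open import Relation.Nullary using (¬_; Dec; yes; no; does; contradiction)
open import Relation.Nullary.Decidable using (map′; ¬?; _×-dec_; _⊎-dec_; dec-true; dec-false)
open import Relation.Binary.PropositionalEquality
  using (_≡_; _≢_; refl; sym; trans; cong; cong₂; subst; module ≡-Reasoning)

open ≡-Reasoning

ΣF-cong : {m : ℕ} {f g : Fin m → ℕ} → (∀ i → f i ≡ g i) → ΣF f ≡ ΣF g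
ΣF-cong {zero}  f≗g = refl
ΣF-cong {suc m} f≗g = cong₂ _+_ (f≗g zero) (ΣF-cong (f≗g ∘ suc))

ΣF-mono : {m : ℕ} {f g : Fin m → ℕ} → (∀ i → f i ≤ g i) → ΣF f ≤ ΣF g
ΣF-mono {zero}  f≤g = z≤n
ΣF-mono {suc m} f≤g = +-mono-≤ (f≤g zero) (ΣF-mono (f≤g ∘ suc))

ΣF-+ : {m : ℕ} (f g : Fin m → ℕ) → ΣF (λ i → f i + g i) ≡ ΣF f + ΣF g
ΣF-+ {zero}  f g = refl
ΣF-+ {suc m} f g = begin
  (f zero + g zero) + ΣF (λ i → f (suc i) + g (suc i))  ≡⟨ cong (f zero + g zero +_) (ΣF-+ (f ∘ suc) (g ∘ suc)) ⟩
  (f zero + g zero) + (ΣF (f ∘ suc) + ΣF (g ∘ suc))     ≡⟨ interchange (f zero) (g zero) _ _ ⟩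
  (f zero + ΣF (f ∘ suc)) + (g zero + ΣF (g ∘ suc))     ∎

ΣF-zero : {m : ℕ} (f : Fin m → ℕ) → (∀ i → f i ≡ 0) → ΣF f ≡ 0
ΣF-zero {zero}  f f≗0 = refl
ΣF-zero {suc m} f f≗0 = cong₂ _+_ (f≗0 zero) (ΣF-zero (f ∘ suc) (f≗0 ∘ suc))

ΣF-one : {m : ℕ} (f : Fin m → ℕ) (j : Fin m) → (∀ i → i ≢ j → f i ≡ 0) → ΣF f ≡ f j
ΣF-one f zero    vanish =
  trans (cong (f zero +_) (ΣF-zero (f ∘ suc) (λ i → vanish (suc i) λ ()))) (+-identityʳ _)
ΣF-one f (suc j) vanish =
  cong₂ _+_ (vanish zero λ ()) (ΣF-one (f ∘ suc) j (λ i i≢j → vanish (suc i) (i≢j ∘ suc-injective)))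

ΣF-pair : {m : ℕ} (f : Fin m → ℕ) (i j : Fin m) → i ≢ j →
          (∀ l → l ≢ i → l ≢ j → f l ≡ 0) → ΣF f ≡ f i + f j
ΣF-pair f zero    zero    i≢j vanish = ⊥-elim (i≢j refl)
ΣF-pair f zero    (suc j) i≢j vanish =
  cong (f zero +_) (ΣF-one (f ∘ suc) j (λ l l≢j → vanish (suc l) (λ ()) (l≢j ∘ suc-injective)))
ΣF-pair f (suc i) zero    i≢j vanish =
  trans (cong (f zero +_) (ΣF-one (f ∘ suc) i (λ l l≢i → vanish (suc l) (l≢i ∘ suc-injective) (λ ()))))
        (+-comm (f zero) (f (suc i)))
ΣF-pair f (suc i) (suc j) i≢j vanish =
  cong₂ _+_ (vanish zero (λ ()) (λ ()))
            (ΣF-pair (f ∘ suc) i j (i≢j ∘ cong suc)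
                     (λ l l≢i l≢j → vanish (suc l) (l≢i ∘ suc-injective) (l≢j ∘ suc-injective)))

indicator : {P : Set} → Dec P → ℕ
indicator P? = if does P? then 1 else 0

indicator-yes : {P : Set} (P? : Dec P) → P → indicator P? ≡ 1
indicator-yes P? p = cong (λ b → if b then 1 else 0) (dec-true P? p)

indicator-no : {P : Set} (P? : Dec P) → ¬ P → indicator P? ≡ 0
indicator-no P? ¬p = cong (λ b → if b then 1 else 0) (dec-false P? ¬p)

length-filter-tabulate : {A : Set} {P : A → Set} (P? : ∀ a → Dec (P a)) {m : ℕ} (f : Fin m → A) →
                         length (filter P? (tabulate f)) ≡ ΣF (λ i → indicator (P? (f i)))
length-filter-tabulate P? {zero}  f = refl
length-filter-tabulate P? {suc m} f with does (P? (f zero))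
... | true  = cong suc (length-filter-tabulate P? (f ∘ suc))
... | false = length-filter-tabulate P? (f ∘ suc)

module _ {m : ℕ} where

  _⊆ᵇ_ : (Fin m → Bool) → (Fin m → Bool) → Set
  B ⊆ᵇ C = ∀ v → B v ≡ true → C v ≡ true

  Disjointᵇ : (Fin m → Bool) → (Fin m → Bool) → Set
  Disjointᵇ B C = ∀ v → B v ≡ true → C v ≡ true → ⊥

  singleton : Fin m → Fin m → Bool
  singleton u v = does (v ≟ u)

  singleton-≡ : ∀ {u v} → singleton u v ≡ true → v ≡ u
  singleton-≡ {u} {v} h with v ≟ u
  singleton-≡ h  | yes v≡u = v≡u
  singleton-≡ () | no _

module _ {k : ℕ} where

  ⊊-respʳ : {X Y Z : Multiset k} → X ⊊ Y → Y ≋ Z → X ⊊ Z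
  ⊊-respʳ (X⊆Y , X≉Y) Y≋Z =
    (λ x → subst (_ ≤_) (Y≋Z x) (X⊆Y x)) , λ X≋Z → X≉Y (λ x → trans (X≋Z x) (sym (Y≋Z x)))

  ⊊-respˡ : {X Y Z : Multiset k} → X ⊊ Y → X ≋ Z → Z ⊊ Y
  ⊊-respˡ (X⊆Y , X≉Y) X≋Z =
    (λ x → subst (_≤ _) (X≋Z x) (X⊆Y x)) , λ Z≋Y → X≉Y (λ x → trans (X≋Z x) (Z≋Y x))

  Nonempty-resp : {X Y : Multiset k} → Nonempty X → X ≋ Y → Nonempty Y
  Nonempty-resp (x , 0<X) X≋Y = x , subst (0 <_) (X≋Y x) 0<X

  _∈ₛ_ : Multiset k → Pair k → Set
  X ∈ₛ P = X ≋ proj₁ P ⊎ X ≋ proj₂ P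

  ≈ₛ-sym : {P Q : Pair k} → P ≈ₛ Q → Q ≈ₛ P
  ≈ₛ-sym (inj₁ (A≋C , B≋D)) = inj₁ ((sym ∘ A≋C) , (sym ∘ B≋D))
  ≈ₛ-sym (inj₂ (A≋D , B≋C)) = inj₂ ((sym ∘ B≋C) , (sym ∘ A≋D))

  ∈ₛ-resp : {X : Multiset k} {P Q : Pair k} → X ∈ₛ P → P ≈ₛ Q → X ∈ₛ Q
  ∈ₛ-resp (inj₁ X≋A) (inj₁ (A≋C , _)) = inj₁ (λ x → trans (X≋A x) (A≋C x))
  ∈ₛ-resp (inj₁ X≋A) (inj₂ (A≋D , _)) = inj₂ (λ x → trans (X≋A x) (A≋D x))
  ∈ₛ-resp (inj₂ X≋B) (inj₁ (_ , B≋D)) = inj₂ (λ x → trans (X≋B x) (B≋D x))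
  ∈ₛ-resp (inj₂ X≋B) (inj₂ (_ , B≋C)) = inj₁ (λ x → trans (X≋B x) (B≋C x))

  ∈ₛ-split-nonempty : {ℳ X : Multiset k} {P : Pair k} → IsSplit ℳ P → X ∈ₛ P → Nonempty X
  ∈ₛ-split-nonempty (A≠∅ , _ , _) (inj₁ X≋A) = Nonempty-resp A≠∅ (sym ∘ X≋A)
  ∈ₛ-split-nonempty (_ , B≠∅ , _) (inj₂ X≋B) = Nonempty-resp B≠∅ (sym ∘ X≋B)

  ∈ₛ-not-⊊ : {X A : Multiset k} {P : Pair k} →
             ¬ (proj₁ P ⊊ A) × ¬ (proj₂ P ⊊ A) → X ∈ₛ P → ¬ (X ⊊ A)
  ∈ₛ-not-⊊ (not₁ , _) (inj₁ X≋A) X⊊A = not₁ (⊊-respˡ X⊊A X≋A)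
  ∈ₛ-not-⊊ (_ , not₂) (inj₂ X≋B) X⊊A = not₂ (⊊-respˡ X⊊A X≋B)

module _ {k m : ℕ} (L : Fin m → Multiset k) where

  restrict : (Fin m → Bool) → Multiset k
  restrict B = ⋃F (λ v → if B v then L v else ∅ₘ)

  restrict-only : ∀ {B u} → B u ≡ true → (∀ v → v ≢ u → B v ≡ false) → restrict B ≋ L u
  restrict-only {B} {u} Bu only x =
    trans (ΣF-one _ u vanish) (cong (λ b → (if b then L u else ∅ₘ) x) Bu)
    where
    vanish : ∀ v → v ≢ u → (if B v then L v else ∅ₘ) x ≡ 0
    vanish v v≢u rewrite only v v≢u = refl

  restrict-singleton : ∀ u → restrict (singleton u) ≋ L u
  restrict-singleton u = restrict-only (dec-true (u ≟ u) refl) (λ v v≢u → dec-false (v ≟ u) v≢u)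

  restrict-⊊ : ∀ {B₁ B₂ B₃} → B₁ ⊆ᵇ B₃ → B₂ ⊆ᵇ B₃ → Disjointᵇ B₁ B₂ →
               Nonempty (restrict B₂) → restrict B₁ ⊊ restrict B₃
  restrict-⊊ {B₁} {B₂} {B₃} B₁⊆B₃ B₂⊆B₃ disjoint (x₀ , 0<B₂) =
    (λ x → ≤-trans (m≤m+n _ _) (sum≤ x)) ,
    λ B₁≋B₃ → <⇒≢ (<-≤-trans (m<m+n _ 0<B₂) (sum≤ x₀)) (B₁≋B₃ x₀)
    where
    term≤ : ∀ v x → (if B₁ v then L v else ∅ₘ) x + (if B₂ v then L v else ∅ₘ) x
                     ≤ (if B₃ v then L v else ∅ₘ) x
    term≤ v x with B₁ v in B₁v | B₂ v in B₂v
    ... | true  | true  = ⊥-elim (disjoint v B₁v B₂v)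
    ... | true  | false rewrite B₁⊆B₃ v B₁v = ≤-reflexive (+-identityʳ _)
    ... | false | true  rewrite B₂⊆B₃ v B₂v = ≤-refl
    ... | false | false = z≤n

    sum≤ : ∀ x → restrict B₁ x + restrict B₂ x ≤ restrict B₃ x
    sum≤ x = subst (_≤ restrict B₃ x)
                   (ΣF-+ (λ v → (if B₁ v then L v else ∅ₘ) x) (λ v → (if B₂ v then L v else ∅ₘ) x))
                   (ΣF-mono (λ v → term≤ v x))

module TreeGeometry (T : Tree) where

  private
    V = Vertex T
    E = Edge T
    par = parent T

  infix 4 _≼_

  data _≼_ (u : V) : V → Set where
    here : u ≼ u
    step : ∀ {j} → u ≼ par j → u ≼ suc j

  ≼-toℕ : ∀ {u v} → u ≼ v → toℕ u ≤ toℕ v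
  ≼-toℕ here              = ≤-refl
  ≼-toℕ (step {j} u≼pj) = ≤-trans (≼-toℕ u≼pj) (≤-trans (ordered T j) (n≤1+n _))

  ≼-trans : ∀ {u v w} → u ≼ v → v ≼ w → u ≼ w
  ≼-trans u≼v here         = u≼v
  ≼-trans u≼v (step v≼pj) = step (≼-trans u≼v v≼pj)

  root-≼ : ∀ v → zero ≼ v
  root-≼ v = bounded (toℕ v) v ≤-refl
    where
    bounded : ∀ b v → toℕ v ≤ b → zero ≼ v
    bounded b       zero    _         = here
    bounded (suc b) (suc j) (s≤s j≤b) = step (bounded b (par j) (≤-trans (ordered T j) j≤b))

  ≼-firstEdge : ∀ {u v} → u ≼ v → u ≢ v → ∃ λ j → par j ≡ u × suc j ≼ v
  ≼-firstEdge here u≢u = ⊥-elim (u≢u refl)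
  ≼-firstEdge {u} (step {j} u≼pj) _ with u ≟ par j
  ... | yes u≡pj = j , sym u≡pj , here
  ... | no u≢pj with ≼-firstEdge u≼pj u≢pj
  ...   | i , pi≡u , si≼pj = i , pi≡u , step si≼pj

  ≼-linear : ∀ {a b v} → a ≼ v → b ≼ v → a ≼ b ⊎ b ≼ a
  ≼-linear here       b≼a       = inj₂ b≼a
  ≼-linear (step a≼p) here       = inj₁ (step a≼p)
  ≼-linear (step a≼p) (step b≼p) = ≼-linear a≼p b≼p

  parent<child : ∀ f → toℕ (par f) < toℕ (suc f)
  parent<child f = s≤s (ordered T f)

  parent≢child : ∀ f → par f ≢ suc f
  parent≢child f pf≡sf = 1+n≰n (subst (λ w → toℕ w < toℕ (suc f)) pf≡sf (parent<child f))

  child⋠parent : ∀ f → ¬ (suc f ≼ par f)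
  child⋠parent f sf≼pf = 1+n≰n (≤-trans (parent<child f) (≼-toℕ sf≼pf))

  sibling-≼ : ∀ {f g} → par f ≡ par g → suc f ≼ suc g → f ≡ g
  sibling-≼ _     here        = refl
  sibling-≼ {f} pf≡pg (step sf≼pg) = ⊥-elim (child⋠parent f (subst (suc f ≼_) (sym pf≡pg) sf≼pg))

  siblings-disjoint : ∀ {f g v} → par f ≡ par g → f ≢ g → suc f ≼ v → suc g ≼ v → ⊥
  siblings-disjoint pf≡pg f≢g sf≼v sg≼v with ≼-linear sf≼v sg≼v
  ... | inj₁ sf≼sg = f≢g (sibling-≼ pf≡pg sf≼sg)
  ... | inj₂ sg≼sf = f≢g (sym (sibling-≼ (sym pf≡pg) sg≼sf))

  below⇒≼ : ∀ fuel u v → below T fuel u v ≡ true → u ≼ v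
  below⇒≼ fuel u v h with u ≟ v
  below⇒≼ fuel    u v       h  | yes refl = here
  below⇒≼ zero    u v       () | no _
  below⇒≼ (suc _) u zero    () | no _
  below⇒≼ (suc fuel) u (suc i) h | no _ = step (below⇒≼ fuel u (par i) h)

  ≼⇒below : ∀ fuel u v → toℕ v ≤ fuel → u ≼ v → below T fuel u v ≡ true
  ≼⇒below fuel u v v≤fuel u≼v with u ≟ v
  ... | yes _ = refl
  ≼⇒below fuel u .u v≤fuel here | no u≢u = ⊥-elim (u≢u refl)
  ≼⇒below (suc fuel) u (suc j) (s≤s j≤fuel) (step u≼pj) | no _ =
    ≼⇒below fuel u (par j) (≤-trans (ordered T j) j≤fuel) u≼pj

  inSubtree⇒≼ : ∀ f v → inSubtree T f v ≡ true → suc f ≼ v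
  inSubtree⇒≼ f v = below⇒≼ _ (suc f) v

  ≼⇒inSubtree : ∀ f v → suc f ≼ v → inSubtree T f v ≡ true
  ≼⇒inSubtree f v = ≼⇒below _ (suc f) v (≤-trans (toℕ≤pred[n] v) (n≤1+n _))

  end : E → Bool → V
  end f true  = suc f
  end f false = par f

  -- side f c is the component of T − f containing end f c; side f (not c) is the
  -- far side of f as seen from end f c.
  side : E → Bool → V → Bool
  side f true  = inSubtree T f
  side f false = not ∘ inSubtree T f

  side-not : ∀ f c v → side f (not c) v ≡ not (side f c v)
  side-not f true  v = refl
  side-not f false v = sym (not-involutive _)

  sides-disjoint : ∀ f c v → side f c v ≡ true → side f (not c) v ≡ true → ⊥
  sides-disjoint f c v in₁ in₂ = not-¬ (sym in₁) (trans (sym in₂) (side-not f c v))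

  sides-cover : ∀ f c v → side f c v ≡ false → side f (not c) v ≡ true
  sides-cover f c v out = trans (side-not f c v) (cong not out)

  near-side : ∀ {C} f c → Disjointᵇ C (side f (not c)) → C ⊆ᵇ side f c
  near-side f c C∌far v Cv with side f c v in h
  ... | true  = refl
  ... | false = ⊥-elim (C∌far v Cv (sides-cover f c v h))

  side-false⇒⋠ : ∀ f v → side f false v ≡ true → ¬ (suc f ≼ v)
  side-false⇒⋠ f v out sf≼v rewrite ≼⇒inSubtree f v sf≼v = contradiction out λ ()

  ⋠⇒side-false : ∀ f v → ¬ (suc f ≼ v) → side f false v ≡ true
  ⋠⇒side-false f v sf⋠v with inSubtree T f v in h
  ... | true  = ⊥-elim (sf⋠v (inSubtree⇒≼ f v h))
  ... | false = refl

  side-end : ∀ f c → side f c (end f c) ≡ true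
  side-end f true  = ≼⇒inSubtree f (suc f) here
  side-end f false = ⋠⇒side-false f (par f) (child⋠parent f)

  end-unique : ∀ f b c {u} → end f b ≡ u → end f c ≡ u → b ≡ c
  end-unique f true  true  _  _  = refl
  end-unique f false false _  _  = refl
  end-unique f true  false sf pf = ⊥-elim (parent≢child f (trans pf (sym sf)))
  end-unique f false true  pf sf = ⊥-elim (parent≢child f (trans pf (sym sf)))

  end∉far : ∀ f c {u} → end f c ≡ u → side f (not c) u ≡ true → ⊥
  end∉far f c refl = sides-disjoint f c _ (side-end f c)

  far-disjoint : ∀ {u} f c g d → end f c ≡ u → end g d ≡ u → f ≢ g →
                 Disjointᵇ (side f (not c)) (side g (not d))
  far-disjoint f true  g true  sf≡u sg≡u f≢g v _ _ = f≢g (suc-injective (trans sf≡u (sym sg≡u)))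
  far-disjoint f false g false pf≡u pg≡u f≢g v in-f in-g =
    siblings-disjoint (trans pf≡u (sym pg≡u)) f≢g (inSubtree⇒≼ f v in-f) (inSubtree⇒≼ g v in-g)
  far-disjoint f true  g false sf≡u pg≡u f≢g v in-f in-g =
    side-false⇒⋠ f v in-f
      (≼-trans (step (subst (suc f ≼_) (trans sf≡u (sym pg≡u)) here)) (inSubtree⇒≼ g v in-g))
  far-disjoint f false g true  pf≡u sg≡u f≢g v in-f in-g =
    far-disjoint g true f false sg≡u pf≡u (f≢g ∘ sym) v in-g in-f

  -- The edge is the first one on the path from u to v.
  far-cover : ∀ u v → v ≢ u → ∃₂ λ f c → end f c ≡ u × side f (not c) v ≡ true
  far-cover zero    v v≢u with ≼-firstEdge (root-≼ v) (v≢u ∘ sym)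
  ... | j , pj≡u , sj≼v = j , false , pj≡u , ≼⇒inSubtree j v sj≼v
  far-cover (suc q) v v≢u with inSubtree T q v in h
  ... | false = q , true , refl , cong not h
  ... | true with ≼-firstEdge (inSubtree⇒≼ q v h) (v≢u ∘ sym)
  ...   | j , pj≡u , sj≼v = j , false , pj≡u , ≼⇒inSubtree j v sj≼v

  At : V → E → Set
  At u f = ∃ λ c → end f c ≡ u

  At? : ∀ u f → Dec (At u f)
  At? u f = map′ fromSum toSum (suc f ≟ u ⊎-dec par f ≟ u)
    where
    fromSum : suc f ≡ u ⊎ par f ≡ u → At u f
    fromSum (inj₁ sf≡u) = true , sf≡u
    fromSum (inj₂ pf≡u) = false , pf≡u
    toSum : At u f → suc f ≡ u ⊎ par f ≡ u
    toSum (true  , sf≡u) = inj₁ sf≡u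
    toSum (false , pf≡u) = inj₂ pf≡u

  lonely-side : ∀ e b {u} → end e b ≡ u → (∀ f → f ≢ e → ¬ At u f) →
                ∀ v → v ≢ u → side e b v ≡ false
  lonely-side e b {u} eu lonely v v≢u with side e b v in in-e
  ... | false = refl
  ... | true with far-cover u v v≢u
  ...   | f , c , fu , far with f ≟ e
  ...     | no f≢e = ⊥-elim (lonely f f≢e (c , fu))
  ...     | yes refl =
    ⊥-elim (sides-disjoint e b v in-e (subst (λ c′ → side e (not c′) v ≡ true) (end-unique e c b fu eu) far))

  incidence : E → V → ℕ
  incidence f u = indicator (suc f ≟ u) + indicator (par f ≟ u)

  children-count : ∀ u → children T u ≡ ΣF (λ f → indicator (par f ≟ u))
  children-count u = length-filter-tabulate (λ f → par f ≟ u) (λ f → f)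

  degree-incidence : ∀ u → degree T u ≡ ΣF (λ f → incidence f u)
  degree-incidence zero    = children-count zero
  degree-incidence (suc i) = begin
    suc (children T (suc i))   ≡⟨ cong suc (children-count (suc i)) ⟩
    1 + ΣF parentEdges         ≡⟨ cong (_+ ΣF parentEdges) (sym ownEdge) ⟩
    ΣF childEdges + ΣF parentEdges ≡⟨ sym (ΣF-+ childEdges parentEdges) ⟩
    ΣF (λ f → incidence f (suc i)) ∎
    where
    childEdges parentEdges : E → ℕ
    childEdges  f = indicator (suc f ≟ suc i)
    parentEdges f = indicator (par f ≟ suc i)
    ownEdge : ΣF childEdges ≡ 1
    ownEdge = trans (ΣF-one childEdges i λ f f≢i → indicator-no (suc f ≟ suc i) (f≢i ∘ suc-injective))
                    (indicator-yes (suc i ≟ suc i) refl)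

  incidence-at : ∀ {u f} → At u f → incidence f u ≡ 1
  incidence-at {f = f} (true , refl) =
    cong₂ _+_ (indicator-yes (suc f ≟ suc f) refl) (indicator-no (par f ≟ suc f) (parent≢child f))
  incidence-at {f = f} (false , refl) =
    cong₂ _+_ (indicator-no (suc f ≟ par f) (parent≢child f ∘ sym)) (indicator-yes (par f ≟ par f) refl)

  incidence-away : ∀ {u f} → ¬ At u f → incidence f u ≡ 0
  incidence-away {u} {f} ¬at =
    cong₂ _+_ (indicator-no (suc f ≟ u) (λ sf≡u → ¬at (true , sf≡u)))
              (indicator-no (par f ≟ u) (λ pf≡u → ¬at (false , pf≡u)))

  degree-lonely : ∀ {u e} → At u e → (∀ f → f ≢ e → ¬ At u f) → degree T u ≡ 1
  degree-lonely {u} {e} at lonely =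
    trans (degree-incidence u)
          (trans (ΣF-one _ e (λ f f≢e → incidence-away (lonely f f≢e))) (incidence-at at))

  degree-pair : ∀ {u e f} → At u e → At u f → e ≢ f →
                (∀ g → g ≢ e → g ≢ f → ¬ At u g) → degree T u ≡ 2
  degree-pair {u} {e} {f} at-e at-f e≢f others =
    trans (degree-incidence u)
          (trans (ΣF-pair _ e f e≢f (λ g g≢e g≢f → incidence-away (others g g≢e g≢f)))
                 (cong₂ _+_ (incidence-at at-e) (incidence-at at-f)))

module _ {k : ℕ} {ℳ : Multiset k} (𝒯 : MTree ℳ) where

  open TreeGeometry (tree 𝒯)

  Side : Edge (tree 𝒯) → Bool → Multiset k
  Side f c = restrict (label 𝒯) (side f c)

  Side-false≋ : ∀ f → Side f false ≋ proj₂ (edgeSplit 𝒯 f)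
  Side-false≋ f x = ΣF-cong (λ v → flip (inSubtree (tree 𝒯) f v) (label 𝒯 v))
    where
    flip : ∀ b (M : Multiset k) → (if not b then M else ∅ₘ) x ≡ (if b then ∅ₘ else M) x
    flip true  M = refl
    flip false M = refl

  Side∈edgeSplit : ∀ f c → Side f c ∈ₛ edgeSplit 𝒯 f
  Side∈edgeSplit f true  = inj₁ (λ _ → refl)
  Side∈edgeSplit f false = inj₂ (Side-false≋ f)

  ∈ₛedgeSplit⇒Side : ∀ {X f} → X ∈ₛ edgeSplit 𝒯 f → ∃ λ c → X ≋ Side f c
  ∈ₛedgeSplit⇒Side         (inj₁ X≋I) = true , X≋I
  ∈ₛedgeSplit⇒Side {f = f} (inj₂ X≋O) = false , λ x → trans (X≋O x) (sym (Side-false≋ f x))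

  module _ (A : Multiset k) (e : Edge (tree 𝒯)) (b : Bool) (A≋Side : A ≋ Side e b)
           (no-Side-⊊ : ∀ f c → f ≢ e → ¬ (Side f c ⊊ A))
           (Side-nonempty : ∀ f c → Nonempty (Side f c)) where

    private
      u = end e b

    Side-⊊-via : ∀ f c → f ≢ e → end f c ≡ u → ∀ B →
                 Disjointᵇ B (side e (not b)) → Disjointᵇ (side f (not c)) B →
                 Nonempty (restrict (label 𝒯) B) → Side f (not c) ⊊ Side e b
    Side-⊊-via f c f≢e fu B B∌far-e far-f∌B B≠∅ =
      restrict-⊊ (label 𝒯) (near-side e b (far-disjoint f c e b fu refl f≢e)) (near-side e b B∌far-e)
                 far-f∌B B≠∅

    far-Side-⊊ : ∀ f c → f ≢ e → end f c ≡ u → Side f (not c) ⊊ Side e b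
    far-Side-⊊ f c f≢e fu with any? (λ x → 0 <? label 𝒯 u x)
    ... | yes λu≠∅ =
      Side-⊊-via f c f≢e fu (singleton u)
        (λ v v≡u → end∉far e b refl ∘ subst (λ w → side e (not b) w ≡ true) (singleton-≡ v≡u))
        (λ v far v≡u → end∉far f c fu (subst (λ w → side f (not c) w ≡ true) (singleton-≡ v≡u) far))
        (Nonempty-resp λu≠∅ (sym ∘ restrict-singleton (label 𝒯) u))
    ... | no λu≡∅ with any? (λ g → ¬? (g ≟ e) ×-dec ¬? (g ≟ f) ×-dec At? u g)
    ...   | yes (g , g≢e , g≢f , d , gu) =
      Side-⊊-via f c f≢e fu (side g (not d))
        (far-disjoint g d e b gu refl g≢e) (far-disjoint f c g d fu gu (g≢f ∘ sym)) (Side-nonempty g (not d))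
    ...   | no no-third =
      ⊥-elim (λu≡∅ (labelsLeaf 𝒯 u (inj₂ (degree-pair (b , refl) (c , fu) (f≢e ∘ sym)
                                          (λ g g≢e g≢f at → no-third (g , g≢e , g≢f , at))))))

    leaf-of-terminal-Side : Σ (Vertex (tree 𝒯)) λ x → isLeaf 𝒯 x × label 𝒯 x ≋ A
    leaf-of-terminal-Side with any? (λ f → ¬? (f ≟ e) ×-dec At? u f)
    ... | no lonely =
      u , degree-lonely (b , refl) lonely′ ,
      λ x → sym (trans (A≋Side x) (restrict-only (label 𝒯) (side-end e b) (lonely-side e b refl lonely′) x))
      where
      lonely′ : ∀ f → f ≢ e → ¬ At u f
      lonely′ f f≢e at = lonely (f , f≢e , at)
    ... | yes (f , f≢e , c , fu) =
      ⊥-elim (no-Side-⊊ f (not c) f≢e (⊊-respʳ (far-Side-⊊ f c f≢e fu) (sym ∘ A≋Side)))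

lemma5 : {k : ℕ} (ℳ : Multiset k) → (∀ x → ℳ x ≥ 1) →
         (𝔖 : SplitSystem ℳ) → Compatible 𝔖 →
         (𝒯 : MTree ℳ) → Represents 𝒯 𝔖 →
         (A : Multiset k) → TerminalSet 𝔖 A →
         Σ (Vertex (tree 𝒯)) λ x → isLeaf 𝒯 x × (label 𝒯 x ≋ A)
lemma5 ℳ _ 𝔖 _ 𝒯 (σ , represents) A (i , A|A̅≈Sᵢ , terminal) =
  leaf-of-terminal-Side 𝒯 A e (proj₁ A-is-Side) (proj₂ A-is-Side) no-Side-⊊ Side-nonempty
  where
  open Inverse σ
  open SplitSystem 𝔖

  e = from i

  A-is-Side : ∃ λ b → A ≋ Side 𝒯 e b
  A-is-Side = ∈ₛedgeSplit⇒Side 𝒯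
    (∈ₛ-resp (∈ₛ-resp (inj₁ λ _ → refl) A|A̅≈Sᵢ)
             (≈ₛ-sym (subst (λ j → edgeSplit 𝒯 e ≈ₛ split j) (strictlyInverseˡ i) (represents e))))

  Side∈split : ∀ f c → Side 𝒯 f c ∈ₛ split (to f)
  Side∈split f c = ∈ₛ-resp (Side∈edgeSplit 𝒯 f c) (represents f)

  no-Side-⊊ : ∀ f c → f ≢ e → ¬ (Side 𝒯 f c ⊊ A)
  no-Side-⊊ f c f≢e =
    ∈ₛ-not-⊊ (terminal (to f) λ to-f≡i → f≢e (trans (sym (strictlyInverseʳ f)) (cong from to-f≡i)))
             (Side∈split f c)

  Side-nonempty : ∀ f c → Nonempty (Side 𝒯 f c)
  Side-nonempty f c = ∈ₛ-split-nonempty (isSplit (to f)) (Side∈split f c)
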